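{- Fix an integer $d\geq 1$. The length of any Stabbing Planes refutation of $\mathrm{PHP}^{n+d}_n$ is $\Omega(n^{1/4})$.
   Context: $\mathrm{PHP}^m_n$ ($m>n$) is the set of integer linear inequalities over variables $P_{i,j}$, $i\in[m]$, $j\in[n]$: $\sum_{j=1}^n P_{i,j}\geq 1$ for all $i\in[m]$, and $P_{i,k}+P_{j,k}\leq 1$ for all $k\in[n]$ and $i\neq j\in[m]$. A Stabbing Planes (SP) refutation of an unsatisfiable set $\mathcal{F}$ of integer linear inequalities in variables $x_1,\dots,x_N$ is a binary tree in which each internal node is labelled by a query $(\mathbf a,b)$ with $\mathbf a\in\mathbb Z^N$, $b\in\mathbb Z$, its two outgoing edges being labelled $\mathbf a\mathbf x\geq b$ and $\mathbf a\mathbf x\leq b-1$, such that for every leaf the linear program consisting of $\mathcal{F}$ together with the inequalities on the edges of the root-to-leaf path is infeasible over $\mathbb R$. Its length is the number of queries. -}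

module Defs where

open import Data.Nat as ℕ using (ℕ; zero; suc)
open import Data.Integer as ℤ using (ℤ; +_; -_)
open import Data.Rational as ℚ using (ℚ; 0ℚ)
open import Data.Fin using (Fin; zero; suc; remQuot)
open import Data.Fin.Properties using (_≟_)
open import Data.Bool using (Bool; true; false; if_then_else_; _∧_; _∨_)
open import Data.Product using (Σ; _×_; _,_)
open import Data.Sum using (_⊎_; inj₁; inj₂)
open import Data.List using (List; []; _∷_)
open import Data.List.Relation.Unary.All using (All)
open import Relation.Nullary using (¬_; does)
open import Relation.Binary.PropositionalEquality using (_≢_)
open import Level using () renaming (suc to lsuc; zero to lzero)

record Ineq (N : ℕ) : Set where
  constructor _≥ᵢ_
  field
    coeff : Fin N → ℤ
    bound : ℤ
open Ineq public

ι : ℤ → ℚ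
ι z = z ℚ./ 1

sumℚ : ∀ {N} → (Fin N → ℚ) → ℚ
sumℚ {zero}  f = 0ℚ
sumℚ {suc N} f = f zero ℚ.+ sumℚ (λ i → f (suc i))

Sat : ∀ {N} → Ineq N → (Fin N → ℚ) → Set
Sat (a ≥ᵢ b) x = ι b ℚ.≤ sumℚ (λ i → ι (a i) ℚ.* x i)

record System (N : ℕ) : Set₁ where
  field
    Idx  : Set
    ineq : Idx → Ineq N
open System public

Infeasible : ∀ {N} → System N → List (Ineq N) → Set
Infeasible F path =
  ¬ (Σ (Fin _ → ℚ) λ x → ((i : Idx F) → Sat (ineq F i) x) × All (λ c → Sat c x) path)

data SPTree (N : ℕ) : Set where
  leaf  : SPTree N
  query : (a : Fin N → ℤ) (b : ℤ) → SPTree N → SPTree N → SPTree N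

spLength : ∀ {N} → SPTree N → ℕ
spLength leaf            = 0
spLength (query a b l r) = suc (spLength l ℕ.+ spLength r)

-- a·x ≥ b  (left edge)   and   a·x ≤ b - 1, i.e. (-a)·x ≥ 1 - b (right edge)
geqEdge : ∀ {N} → (Fin N → ℤ) → ℤ → Ineq N
geqEdge a b = a ≥ᵢ b

leqEdge : ∀ {N} → (Fin N → ℤ) → ℤ → Ineq N
leqEdge a b = (λ i → - a i) ≥ᵢ (- (b ℤ.- + 1))

RefutesFrom : ∀ {N} → System N → List (Ineq N) → SPTree N → Set
RefutesFrom F path leaf            = Infeasible F path
RefutesFrom F path (query a b l r) =
  RefutesFrom F (geqEdge a b ∷ path) l × RefutesFrom F (leqEdge a b ∷ path) r

IsSPRefutation : ∀ {N} → System N → SPTree N → Set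
IsSPRefutation F T = RefutesFrom F [] T

-- The pigeonhole principle PHP^m_n.
-- Variable P_{i,j} (i ∈ [m], j ∈ [n]) is x_{combine i j}, i.e. the index
-- v ∈ Fin (m * n) with remQuot n v = (i , j).

eqb : ∀ {k} → Fin k → Fin k → Bool
eqb i j = does (i ≟ j)

pigeonIneq : (m n : ℕ) → Fin m → Ineq (m ℕ.* n)
pigeonIneq m n i = (λ v → coef (remQuot {m} n v)) ≥ᵢ (+ 1)
  where
    coef : Fin m × Fin n → ℤ
    coef (i' , j) = if eqb i' i then + 1 else + 0

-- P_{i,k} + P_{j,k} ≤ 1, written as  -P_{i,k} - P_{j,k} ≥ -1
holeIneq : (m n : ℕ) → Fin n → Fin m → Fin m → Ineq (m ℕ.* n)
holeIneq m n k i j = (λ v → coef (remQuot {m} n v)) ≥ᵢ (- (+ 1))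
  where
    coef : Fin m × Fin n → ℤ
    coef (i' , k') = if eqb k' k ∧ (eqb i' i ∨ eqb i' j) then - (+ 1) else + 0

PHP : (m n : ℕ) → System (m ℕ.* n)
PHP m n = record
  { Idx  = Fin m ⊎ (Fin n × Σ (Fin m × Fin m) (λ { (i , j) → i ≢ j }))
  ; ineq = λ { (inj₁ i) → pigeonIneq m n i
             ; (inj₂ (k , (i , j) , _)) → holeIneq m n k i j }
  }

module Submission where

-- Choose a nonempty J ⊆ [n] of even size such that Σ_{k ∈ J} Σ_i a_{i,k} is even for every
-- query a, and put P_{i,k} = ½ for k ∈ J and 0 otherwise.  Every pigeon gets |J|/2 ≥ 1, every
-- hole at most 1, and every query takes an integer value, so the point lies on one side of each
-- query and the path it follows ends in a leaf whose LP it satisfies.  The conditions on J are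
-- L + 1 linear equations over 𝔽₂, so such J exists once n > L + 1; hence L ≥ n - 1.

open import Defs
open import Data.Nat as ℕ using (ℕ; zero; suc; s≤s; z≤n)
import Data.Nat.Properties as ℕP
open import Data.Product using (Σ; _,_)

module 𝔽₂-Linear where

  open import Algebra.Bundles using (CommutativeRing)
  import Algebra.Properties.Semiring.Sum as SemiringSum
  open import Data.Bool using (Bool; true; false; _∧_; _xor_)
  open import Data.Bool.Properties using (xor-∧-commutativeRing; xor-same; xor-comm; ∧-distribʳ-xor; ∧-zeroʳ)
  open import Data.Fin using (zero; suc)
  open import Data.List using (List; []; _∷_; _++_; map; length)
  open import Data.List.Properties using (length-map; length-++)
  open import Data.List.Relation.Unary.All as All using (All; []; _∷_)
  open import Data.List.Relation.Unary.All.Properties using (++⁺; ++⁻; map⁻)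
  open import Data.Nat using (_<_)
  open import Data.Product using (∃-syntax; _×_; proj₁; proj₂)
  open import Data.Vec.Functional as V using (Vector; head; tail; replicate; zipWith)
  open import Function using (_∘_)
  open import Relation.Binary.PropositionalEquality

  private
    module 𝔽₂ = SemiringSum (CommutativeRing.semiring xor-∧-commutativeRing)

  infix 7 _·_

  _·_ : ∀ {D} → Vector Bool D → Vector Bool D → Bool
  c · J = 𝔽₂.sum (λ i → c i ∧ J i)

  ·-distribʳ-xor : ∀ {D} (c g J : Vector Bool D) → zipWith _xor_ c g · J ≡ (c · J) xor (g · J)
  ·-distribʳ-xor c g J = trans
    (𝔽₂.sum-cong-≗ (λ i → ∧-distribʳ-xor (J i) (c i) (g i)))
    (𝔽₂.∑-distrib-+ (λ i → c i ∧ J i) (λ i → g i ∧ J i))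

  ·-zeroʳ : ∀ {D} (c : Vector Bool D) → c · replicate D false ≡ false
  ·-zeroʳ {D} c = trans (𝔽₂.sum-cong-≗ (∧-zeroʳ ∘ c)) (𝔽₂.sum-replicate-zero D)

  Nonzero : ∀ {D} → Vector Bool D → Set
  Nonzero J = ∃[ t ] J t ≡ true

  data Pivot {D : ℕ} : List (Vector Bool (suc D)) → Set where
    none : ∀ {fs} → All (λ c → head c ≡ false) fs → Pivot fs
    some : ∀ pre g post → head g ≡ true → Pivot (pre ++ g ∷ post)

  pivot : ∀ {D} (fs : List (Vector Bool (suc D))) → Pivot fs
  pivot [] = none []
  pivot (c ∷ fs) with head c in c₀
  ... | true = some [] c fs c₀
  ... | false with pivot fs
  ...   | none ps            = none (c₀ ∷ ps)
  ...   | some pre g post g₀ = some (c ∷ pre) g post g₀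

  -- Gaussian elimination of the first coordinate with the pivot g: the root J′ of the
  -- reduced forms extends to the root of the original forms whose first entry makes g vanish.
  reduce : ∀ {D} → Vector Bool (suc D) → Vector Bool (suc D) → Vector Bool D
  reduce g c with head c
  ... | true  = zipWith _xor_ (tail c) (tail g)
  ... | false = tail c

  extend : ∀ {D} → Vector Bool (suc D) → Vector Bool D → Vector Bool (suc D)
  extend g J′ = (tail g · J′) V.∷ J′

  ·-extend : ∀ {D} (g c : Vector Bool (suc D)) (J′ : Vector Bool D) →
    c · extend g J′ ≡ reduce g c · J′
  ·-extend g c J′ with head c
  ... | false = refl
  ... | true  = trans (xor-comm (tail g · J′) (tail c · J′)) (sym (·-distribʳ-xor (tail c) (tail g) J′))

  pivot-·-extend : ∀ {D} (g : Vector Bool (suc D)) (J′ : Vector Bool D) →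
    head g ≡ true → g · extend g J′ ≡ false
  pivot-·-extend g J′ g₀ rewrite g₀ = xor-same (tail g · J′)

  kernel-nontrivial : ∀ D (fs : List (Vector Bool D)) → length fs < D →
    ∃[ J ] Nonzero J × All (λ c → c · J ≡ false) fs
  kernel-nontrivial (suc D) fs |fs|<1+D with pivot fs
  ... | none ps = true V.∷ replicate D false , (zero , refl) , All.map (λ {c} → vanish c) ps
    where
      vanish : ∀ c → head c ≡ false → c · (true V.∷ replicate D false) ≡ false
      vanish c c₀ rewrite c₀ = ·-zeroʳ (tail c)
  ... | some pre g post g₀
    with kernel-nontrivial D (map (reduce g) (pre ++ post)) |reduced|<D
    where
      |reduced|<D : length (map (reduce g) (pre ++ post)) < D
      |reduced|<D rewrite length-map (reduce g) (pre ++ post) | length-++ pre {post}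
                        | length-++ pre {g ∷ post} | ℕP.+-suc (length pre) (length post)
        = ℕP.≤-pred |fs|<1+D
  ...   | J′ , (t , J′t) , vanish =
    extend g J′ , (suc t , J′t) , ++⁺ (lift (proj₁ split)) (pivot-·-extend g J′ g₀ ∷ lift (proj₂ split))
    where
      split : All (λ c → reduce g c · J′ ≡ false) pre × All (λ c → reduce g c · J′ ≡ false) post
      split = ++⁻ pre (map⁻ vanish)
      lift : ∀ {cs} → All (λ c → reduce g c · J′ ≡ false) cs → All (λ c → c · extend g J′ ≡ false) cs
      lift = All.map (λ {c} → trans (·-extend g c J′))

module IntegerSums where

  open import Data.Bool using (Bool; true; false; _∧_; _∨_; _xor_; if_then_else_)
  open import Data.Bool.Properties using (∧-zeroʳ; ∧-identityʳ)
  open import Data.Empty using (⊥-elim)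
  open import Data.Fin using (Fin; zero; suc; _↑ˡ_; _↑ʳ_; remQuot; combine; punchIn)
  open import Data.Fin.Properties using (remQuot-combine; punchInᵢ≢i; _≟_)
  open import Data.Integer as ℤ using (ℤ; +_; -[1+_]; _+_; _*_)
  open import Data.Integer.DivMod using (_%ℕ_; _/ℕ_; n%ℕd<d; a≡a%ℕn+[a/ℕn]*n)
  import Data.Integer.Properties as ℤP
  open import Data.Integer.Tactic.RingSolver using (solve-∀)
  open import Data.Nat using (_<_)
  open import Data.Product using (_×_)
  open import Data.Vec.Functional using (Vector; tail; removeAt)
  open import Function using (_∘_)
  open import Relation.Binary.PropositionalEquality
  open import Relation.Nullary using (yes; no)
  open import Relation.Nullary.Decidable using (dec-true; dec-false)
  open import Algebra.Properties.Semiring.Sum ℤP.+-*-semiring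
    using (sum; sum-syntax; sum-cong-≗; sum-remove; sum-replicate-zero; ∑-distrib-+)
  open 𝔽₂-Linear using (_·_)

  ∑-zero : ∀ {N} (f : Vector ℤ N) → (∀ k → f k ≡ + 0) → sum f ≡ + 0
  ∑-zero {N} f f≡0 = trans (sum-cong-≗ f≡0) (sum-replicate-zero N)

  ∑-++ : ∀ p q (f : Vector ℤ (p ℕ.+ q)) →
    ∑[ v < p ℕ.+ q ] f v ≡ ∑[ i < p ] f (i ↑ˡ q) + ∑[ j < q ] f (p ↑ʳ j)
  ∑-++ zero    q f = sym (ℤP.+-identityˡ _)
  ∑-++ (suc p) q f = trans (cong (_+_ (f zero)) (∑-++ p q (tail f))) (sym (ℤP.+-assoc (f zero) _ _))

  ∑-combine : ∀ m n (f : Vector ℤ (m ℕ.* n)) →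
    ∑[ v < m ℕ.* n ] f v ≡ ∑[ i < m ] ∑[ k < n ] f (combine i k)
  ∑-combine zero    n f = refl
  ∑-combine (suc m) n f =
    trans (∑-++ n (m ℕ.* n) f)
          (cong (_+_ (∑[ k < n ] f (k ↑ˡ m ℕ.* n))) (∑-combine m n (λ w → f (n ↑ʳ w))))

  ∑-remQuot : ∀ m n (H : Fin m × Fin n → ℤ) →
    ∑[ v < m ℕ.* n ] H (remQuot {m} n v) ≡ ∑[ i < m ] ∑[ k < n ] H (i , k)
  ∑-remQuot m n H = trans (∑-combine m n (H ∘ remQuot n))
    (sum-cong-≗ λ i → sum-cong-≗ λ k → cong H (remQuot-combine i k))

  ∑-concentrated : ∀ {N} (f : Vector ℤ N) (i : Fin N) → (∀ j → j ≢ i → f j ≡ + 0) → sum f ≡ f i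
  ∑-concentrated {suc N} f i vanish = begin
    sum f                     ≡⟨ sum-remove f ⟩
    f i + sum (removeAt f i)  ≡⟨ cong (_+_ (f i)) (∑-zero _ λ j → vanish _ (punchInᵢ≢i i j)) ⟩
    f i + + 0                 ≡⟨ ℤP.+-identityʳ (f i) ⟩
    f i                       ∎
    where open ≡-Reasoning

  ∑-nonNeg : ∀ {N} (f : Vector ℤ N) → (∀ k → + 0 ℤ.≤ f k) → + 0 ℤ.≤ sum f
  ∑-nonNeg {zero}  f f≥0 = ℤP.≤-refl
  ∑-nonNeg {suc N} f f≥0 = ℤP.+-mono-≤ (f≥0 zero) (∑-nonNeg (tail f) (f≥0 ∘ suc))

  term-≤-∑ : ∀ {N} (f : Vector ℤ N) (i : Fin N) → (∀ k → + 0 ℤ.≤ f k) → f i ℤ.≤ sum f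
  term-≤-∑ {suc N} f i f≥0 = begin
    f i                       ≡⟨ ℤP.+-identityʳ (f i) ⟨
    f i + + 0                 ≤⟨ ℤP.+-monoʳ-≤ (f i) (∑-nonNeg (removeAt f i) (f≥0 ∘ punchIn i)) ⟩
    f i + sum (removeAt f i)  ≡⟨ sum-remove f ⟨
    sum f                     ∎
    where open ℤP.≤-Reasoning

  eqb-refl : ∀ {N} (i : Fin N) → eqb i i ≡ true
  eqb-refl i = dec-true (i ≟ i) refl

  eqb-≢ : ∀ {N} {i j : Fin N} → i ≢ j → eqb i j ≡ false
  eqb-≢ {i = i} {j} i≢j = dec-false (i ≟ j) i≢j

  ∑-indicator : ∀ {N} (i : Fin N) c → ∑[ i′ < N ] (if eqb i′ i then c else + 0) ≡ c
  ∑-indicator i c = trans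
    (∑-concentrated _ i λ i′ i′≢i → cong (if_then c else + 0) (eqb-≢ i′≢i))
    (cong (if_then c else + 0) (eqb-refl i))

  ∑-indicator-pair : ∀ {N} {i j : Fin N} c → i ≢ j →
    ∑[ i′ < N ] (if eqb i′ i ∨ eqb i′ j then c else + 0) ≡ c + c
  ∑-indicator-pair {N} {i} {j} c i≢j = begin
    ∑[ i′ < N ] (if eqb i′ i ∨ eqb i′ j then c else + 0)
      ≡⟨ sum-cong-≗ split ⟩
    ∑[ i′ < N ] (δ i i′ + δ j i′)
      ≡⟨ ∑-distrib-+ (δ i) (δ j) ⟩
    ∑[ i′ < N ] δ i i′ + ∑[ i′ < N ] δ j i′
      ≡⟨ cong₂ _+_ (∑-indicator i c) (∑-indicator j c) ⟩
    c + c ∎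
    where
      open ≡-Reasoning
      δ : Fin N → Fin N → ℤ
      δ i i′ = if eqb i′ i then c else + 0
      split : ∀ i′ → (if eqb i′ i ∨ eqb i′ j then c else + 0) ≡ δ i i′ + δ j i′
      split i′ with i′ ≟ i | i′ ≟ j
      ... | yes refl | yes refl = ⊥-elim (i≢j refl)
      ... | yes _    | no  _    = sym (ℤP.+-identityʳ c)
      ... | no  _    | yes _    = sym (ℤP.+-identityˡ c)
      ... | no  _    | no  _    = refl

  ⟦_⟧ : Bool → ℤ
  ⟦ true  ⟧ = + 1
  ⟦ false ⟧ = + 0

  ⟦⟧-nonNeg : ∀ b → + 0 ℤ.≤ ⟦ b ⟧
  ⟦⟧-nonNeg true  = ℤ.+≤+ z≤n
  ⟦⟧-nonNeg false = ℤ.+≤+ z≤n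

  ⟦⟧-+ : ∀ a b → ⟦ a ⟧ + ⟦ b ⟧ ≡ ⟦ a xor b ⟧ + ⟦ a ∧ b ⟧ * + 2
  ⟦⟧-+ false false = refl
  ⟦⟧-+ false true  = refl
  ⟦⟧-+ true  false = refl
  ⟦⟧-+ true  true  = refl

  infix 2 _withQuotient_

  record HasParity (z : ℤ) (b : Bool) : Set where
    constructor _withQuotient_
    field
      quotient      : ℤ
      decomposition : z ≡ ⟦ b ⟧ + quotient * + 2

  odd : ℤ → Bool
  odd z = (z %ℕ 2) ℕ.≡ᵇ 1

  hasParity-odd : ∀ z → HasParity z (odd z)
  hasParity-odd z = from-remainder (z %ℕ 2) (n%ℕd<d z 2) (a≡a%ℕn+[a/ℕn]*n z 2)
    where
      from-remainder : ∀ r → r < 2 → z ≡ + r + (z /ℕ 2) * + 2 → HasParity z (r ℕ.≡ᵇ 1)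
      from-remainder 0 _ z≡ = z /ℕ 2 withQuotient z≡
      from-remainder 1 _ z≡ = z /ℕ 2 withQuotient z≡
      from-remainder (suc (suc r)) (s≤s (s≤s ()))

  hasParity-+ : ∀ {x y a b} → HasParity x a → HasParity y b → HasParity (x + y) (a xor b)
  hasParity-+ {a = a} {b} (s withQuotient refl) (t withQuotient refl) =
    s + t + ⟦ a ∧ b ⟧ withQuotient (begin
      ⟦ a ⟧ + s * + 2 + (⟦ b ⟧ + t * + 2)           ≡⟨ regroup ⟦ a ⟧ ⟦ b ⟧ s t ⟩
      ⟦ a ⟧ + ⟦ b ⟧ + (s + t) * + 2                 ≡⟨ cong (_+ (s + t) * + 2) (⟦⟧-+ a b) ⟩
      ⟦ a xor b ⟧ + ⟦ a ∧ b ⟧ * + 2 + (s + t) * + 2 ≡⟨ collect ⟦ a xor b ⟧ ⟦ a ∧ b ⟧ s t ⟩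
      ⟦ a xor b ⟧ + (s + t + ⟦ a ∧ b ⟧) * + 2       ∎)
    where
      open ≡-Reasoning
      regroup : ∀ p q s t → p + s * + 2 + (q + t * + 2) ≡ p + q + (s + t) * + 2
      regroup = solve-∀
      collect : ∀ p q s t → p + q * + 2 + (s + t) * + 2 ≡ p + (s + t + q) * + 2
      collect = solve-∀

  hasParity-*⟦⟧ : ∀ {x a} → HasParity x a → ∀ j → HasParity (x * ⟦ j ⟧) (a ∧ j)
  hasParity-*⟦⟧ {x} {a} _ false rewrite ∧-zeroʳ a = + 0 withQuotient ℤP.*-zeroʳ x
  hasParity-*⟦⟧ {x} {a} (t withQuotient x≡) true
    rewrite ℤP.*-identityʳ x | ∧-identityʳ a = t withQuotient x≡

  hasParity-∑ : ∀ {n} (C : Vector ℤ n) (J : Vector Bool n) →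
    HasParity (∑[ k < n ] (C k * ⟦ J k ⟧)) ((odd ∘ C) · J)
  hasParity-∑ {zero}  C J = + 0 withQuotient refl
  hasParity-∑ {suc n} C J =
    hasParity-+ (hasParity-*⟦⟧ (hasParity-odd (C zero)) (J zero)) (hasParity-∑ (tail C) (tail J))

  even-quotient : ∀ {z b} (p : HasParity z b) → b ≡ false → z ≡ HasParity.quotient p * + 2
  even-quotient (t withQuotient z≡) refl = trans z≡ (ℤP.+-identityˡ (t * + 2))

  positive-even-≥2 : ∀ {z} t → z ≡ t * + 2 → + 1 ℤ.≤ z → + 2 ℤ.≤ z
  positive-even-≥2 (+ 0)     refl (ℤ.+≤+ ())
  positive-even-≥2 (+ suc k) refl _ = ℤ.+≤+ (s≤s (s≤s z≤n))
  positive-even-≥2 -[1+ k ]  refl ()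

module HalfIntegralPoints where

  open import Data.Integer as ℤ using (ℤ; +_; -_; _+_; _*_)
  import Data.Integer.Properties as ℤP
  open import Data.Integer.Tactic.RingSolver using (solve-∀)
  open import Data.Fin using (zero; suc)
  open import Data.Rational as ℚ using (ℚ; ½; toℚᵘ)
  open import Data.Rational.Properties using (toℚᵘ-fromℚᵘ; toℚᵘ-homo-*; toℚᵘ-homo-+; toℚᵘ-cancel-≤)
  open import Data.Rational.Unnormalised as ℚᵘ using (mkℚᵘ; _≃_; *≡*; *≤*)
  import Data.Rational.Unnormalised.Properties as ℚᵘP
  open import Data.Sum using (_⊎_; inj₁; inj₂)
  open import Data.Vec.Functional using (Vector; tail)
  open import Function using (_∘_)
  open import Relation.Binary.PropositionalEquality
  open import Relation.Nullary using (yes; no)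
  open import Algebra.Properties.Semiring.Sum ℤP.+-*-semiring using (sum; sum-syntax; sum-cong-≗; *-distribˡ-sum)

  half : ∀ {N} → Vector ℤ N → Vector ℚ N
  half y v = ι (y v) ℚ.* ½

  -- The second field of mkℚᵘ is the denominator minus one, so mkℚᵘ z 1 is z / 2.
  toℚᵘ-ι-*-half : ∀ a y → toℚᵘ (ι a ℚ.* (ι y ℚ.* ½)) ≃ mkℚᵘ (a * y) 1
  toℚᵘ-ι-*-half a y = begin
    toℚᵘ (ι a ℚ.* (ι y ℚ.* ½))
      ≈⟨ toℚᵘ-homo-* (ι a) _ ⟩
    toℚᵘ (ι a) ℚᵘ.* toℚᵘ (ι y ℚ.* ½)
      ≈⟨ ℚᵘP.*-congˡ {toℚᵘ (ι a)} (toℚᵘ-homo-* (ι y) ½) ⟩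
    toℚᵘ (ι a) ℚᵘ.* (toℚᵘ (ι y) ℚᵘ.* toℚᵘ ½)
      ≈⟨ ℚᵘP.*-cong (toℚᵘ-ι a) (ℚᵘP.*-congʳ (toℚᵘ-ι y)) ⟩
    mkℚᵘ a 0 ℚᵘ.* (mkℚᵘ y 0 ℚᵘ.* mkℚᵘ (+ 1) 1)
      ≈⟨ *≡* (regroup a y) ⟩
    mkℚᵘ (a * y) 1 ∎
    where
      open ℚᵘP.≃-Reasoning
      toℚᵘ-ι : ∀ z → toℚᵘ (ι z) ≃ mkℚᵘ z 0
      toℚᵘ-ι z = toℚᵘ-fromℚᵘ (mkℚᵘ z 0)
      regroup : ∀ a y → (a * (y * + 1)) * + 2 ≡ (a * y) * + 2
      regroup = solve-∀

  toℚᵘ-sumℚ-halves : ∀ {N} (f : Vector ℚ N) (g : Vector ℤ N) →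
    (∀ i → toℚᵘ (f i) ≃ mkℚᵘ (g i) 1) → toℚᵘ (sumℚ f) ≃ mkℚᵘ (sum g) 1
  toℚᵘ-sumℚ-halves {zero}  f g f≃g = *≡* refl
  toℚᵘ-sumℚ-halves {suc N} f g f≃g = begin
    toℚᵘ (sumℚ f)
      ≈⟨ toℚᵘ-homo-+ (f zero) _ ⟩
    toℚᵘ (f zero) ℚᵘ.+ toℚᵘ (sumℚ (tail f))
      ≈⟨ ℚᵘP.+-cong (f≃g zero) (toℚᵘ-sumℚ-halves (tail f) (tail g) (f≃g ∘ suc)) ⟩
    mkℚᵘ (g zero) 1 ℚᵘ.+ mkℚᵘ (sum (tail g)) 1
      ≈⟨ *≡* (add-halves (g zero) _) ⟩
    mkℚᵘ (sum g) 1 ∎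
    where
      open ℚᵘP.≃-Reasoning
      add-halves : ∀ p q → (p * + 2 + q * + 2) * + 2 ≡ (p + q) * + 4
      add-halves = solve-∀

  sat-half : ∀ {N} (a : Vector ℤ N) b (y : Vector ℤ N) →
    b * + 2 ℤ.≤ ∑[ v < N ] (a v * y v) → Sat (a ≥ᵢ b) (half y)
  sat-half a b y 2b≤a·y = toℚᵘ-cancel-≤
    (ℚᵘP.≤-respˡ-≃ (ℚᵘP.≃-sym (toℚᵘ-fromℚᵘ (mkℚᵘ b 0)))
      (ℚᵘP.≤-respʳ-≃ (ℚᵘP.≃-sym (toℚᵘ-sumℚ-halves _ _ λ v → toℚᵘ-ι-*-half (a v) (y v)))
        (*≤* (subst (b * + 2 ℤ.≤_) (sym (ℤP.*-identityʳ _)) 2b≤a·y))))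

  ∑-neg-* : ∀ {N} (a y : Vector ℤ N) → ∑[ v < N ] ((- a v) * y v) ≡ - ∑[ v < N ] (a v * y v)
  ∑-neg-* {N} a y = begin
    ∑[ v < N ] ((- a v) * y v)        ≡⟨ sum-cong-≗ (λ v → pull-sign (a v) (y v)) ⟩
    ∑[ v < N ] (- + 1 * (a v * y v))  ≡⟨ *-distribˡ-sum (- + 1) (λ v → a v * y v) ⟨
    - + 1 * ∑[ v < N ] (a v * y v)    ≡⟨ ℤP.-1*i≡-i _ ⟩
    - ∑[ v < N ] (a v * y v)          ∎
    where
      open ≡-Reasoning
      pull-sign : ∀ a y → (- a) * y ≡ - + 1 * (a * y)
      pull-sign = solve-∀

  -- If a·y = 2t then a·(half y) = t is an integer, so it is either ≥ b or ≤ b - 1.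
  half-decides : ∀ {N} (a : Vector ℤ N) b (y : Vector ℤ N) t →
    ∑[ v < N ] (a v * y v) ≡ t * + 2 → Sat (geqEdge a b) (half y) ⊎ Sat (leqEdge a b) (half y)
  half-decides {N} a b y t a·y≡2t with b ℤ.≤? t
  ... | yes b≤t = inj₁ (sat-half a b y (subst (b * + 2 ℤ.≤_) (sym a·y≡2t) (ℤP.*-monoʳ-≤-nonNeg (+ 2) b≤t)))
  ... | no  b≰t = inj₂ (sat-half (λ v → - a v) (- (b ℤ.- + 1)) y (begin
    - (b ℤ.- + 1) * + 2         ≡⟨ ℤP.neg-distribˡ-* (b ℤ.- + 1) (+ 2) ⟨
    - ((b ℤ.- + 1) * + 2)       ≤⟨ ℤP.neg-mono-≤ (ℤP.*-monoʳ-≤-nonNeg (+ 2) t≤b-1) ⟩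
    - (t * + 2)                 ≡⟨ cong -_ a·y≡2t ⟨
    - ∑[ v < N ] (a v * y v)    ≡⟨ ∑-neg-* a y ⟨
    ∑[ v < N ] ((- a v) * y v)  ∎))
    where
      open ℤP.≤-Reasoning
      t≤b-1 : t ℤ.≤ b ℤ.- + 1
      t≤b-1 = subst (t ℤ.≤_) (ℤP.+-comm ℤ.-1ℤ b) (ℤP.i<j⇒i≤pred[j] (ℤP.≰⇒> b≰t))

module PigeonholePoint where

  open import Data.Bool using (Bool; true; false; _∧_; _∨_; if_then_else_)
  open import Data.Fin using (Fin; remQuot; combine)
  open import Data.Fin.Properties using (remQuot-combine)
  open import Data.Integer as ℤ using (ℤ; +_; -_; _+_; _*_)
  import Data.Integer.Properties as ℤP
  open import Data.Product using (_×_; proj₂)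
  open import Data.Sum using (_⊎_; inj₁; inj₂)
  open import Data.Vec.Functional using (Vector)
  open import Function using (_∘_)
  open import Relation.Binary.PropositionalEquality
  open import Algebra.Properties.Semiring.Sum ℤP.+-*-semiring
    using (sum; sum-syntax; sum-cong-≗; ∑-comm; *-distribʳ-sum)
  open 𝔽₂-Linear using (_·_; Nonzero)
  open IntegerSums
  open HalfIntegralPoints using (half; sat-half; half-decides)

  even-support-≥2 : ∀ {n} (J : Vector Bool n) → Nonzero J → (λ _ → true) · J ≡ false →
    + 2 ℤ.≤ ∑[ k < n ] ⟦ J k ⟧
  even-support-≥2 {n} J (t , Jt) even = positive-even-≥2 (HasParity.quotient parity) |J|≡2s |J|≥1
    where
      parity : HasParity (∑[ k < n ] (+ 1 * ⟦ J k ⟧)) ((λ _ → true) · J)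
      parity = hasParity-∑ (λ _ → + 1) J
      |J|≡2s : ∑[ k < n ] ⟦ J k ⟧ ≡ HasParity.quotient parity * + 2
      |J|≡2s = trans (sum-cong-≗ (λ k → sym (ℤP.*-identityˡ ⟦ J k ⟧))) (even-quotient parity even)
      |J|≥1 : + 1 ℤ.≤ ∑[ k < n ] ⟦ J k ⟧
      |J|≥1 = subst (ℤ._≤ _) (cong ⟦_⟧ Jt) (term-≤-∑ (⟦_⟧ ∘ J) t (⟦⟧-nonNeg ∘ J))

  module _ (m n : ℕ) where

    columnSum : Vector ℤ (m ℕ.* n) → Vector ℤ n
    columnSum a k = ∑[ i < m ] a (combine i k)

    columnParity : Vector ℤ (m ℕ.* n) → Vector Bool n
    columnParity a = odd ∘ columnSum a

    -- Twice the point P_{i,k} = ½ [k ∈ J].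
    columnIndicator : Vector Bool n → Vector ℤ (m ℕ.* n)
    columnIndicator J v = ⟦ J (proj₂ (remQuot {m} n v)) ⟧

    module _ (J : Vector Bool n) where

      private
        y : Vector ℤ (m ℕ.* n)
        y = columnIndicator J

      ∑-columnIndicator : ∀ a → ∑[ v < m ℕ.* n ] (a v * y v) ≡ ∑[ k < n ] (columnSum a k * ⟦ J k ⟧)
      ∑-columnIndicator a = begin
        ∑[ v < m ℕ.* n ] (a v * y v)
          ≡⟨ ∑-combine m n (λ v → a v * y v) ⟩
        ∑[ i < m ] ∑[ k < n ] (a (combine i k) * y (combine i k))
          ≡⟨ sum-cong-≗ (λ i → sum-cong-≗ λ k →
               cong (λ p → a (combine i k) * ⟦ J (proj₂ p) ⟧) (remQuot-combine {m} i k)) ⟩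
        ∑[ i < m ] ∑[ k < n ] (a (combine i k) * ⟦ J k ⟧)
          ≡⟨ ∑-comm (λ (i : Fin m) k → a (combine i k) * ⟦ J k ⟧) ⟩
        ∑[ k < n ] ∑[ i < m ] (a (combine i k) * ⟦ J k ⟧)
          ≡⟨ sum-cong-≗ (λ k → *-distribʳ-sum ⟦ J k ⟧ (λ (i : Fin m) → a (combine i k))) ⟨
        ∑[ k < n ] (columnSum a k * ⟦ J k ⟧) ∎
        where open ≡-Reasoning

      decides-even-column-query : ∀ a b → columnParity a · J ≡ false →
        Sat (geqEdge a b) (half y) ⊎ Sat (leqEdge a b) (half y)
      decides-even-column-query a b even = half-decides a b y (HasParity.quotient parity)
        (trans (∑-columnIndicator a) (even-quotient parity even))
        where
          parity : HasParity (∑[ k < n ] (columnSum a k * ⟦ J k ⟧)) (columnParity a · J)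
          parity = hasParity-∑ (columnSum a) J

      pigeon-value : ∀ i → ∑[ v < m ℕ.* n ] (coeff (pigeonIneq m n i) v * y v) ≡ ∑[ k < n ] ⟦ J k ⟧
      pigeon-value i = begin
        ∑[ v < m ℕ.* n ] H (remQuot {m} n v)
          ≡⟨ ∑-remQuot m n H ⟩
        ∑[ i′ < m ] ∑[ k < n ] H (i′ , k)
          ≡⟨ ∑-concentrated _ i other-rows-vanish ⟩
        ∑[ k < n ] H (i , k)
          ≡⟨ sum-cong-≗ (λ k → cong (λ p → (if p then + 1 else + 0) * ⟦ J k ⟧) (eqb-refl i)) ⟩
        ∑[ k < n ] (+ 1 * ⟦ J k ⟧)
          ≡⟨ sum-cong-≗ (λ k → ℤP.*-identityˡ ⟦ J k ⟧) ⟩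
        ∑[ k < n ] ⟦ J k ⟧ ∎
        where
          open ≡-Reasoning
          H : Fin m × Fin n → ℤ
          H (i′ , k) = (if eqb i′ i then + 1 else + 0) * ⟦ J k ⟧
          other-rows-vanish : ∀ i′ → i′ ≢ i → ∑[ k < n ] H (i′ , k) ≡ + 0
          other-rows-vanish i′ i′≢i rewrite eqb-≢ i′≢i = ∑-zero _ (λ k → ℤP.*-zeroˡ ⟦ J k ⟧)

      hole-value : ∀ k {i j} → i ≢ j →
        ∑[ v < m ℕ.* n ] (coeff (holeIneq m n k i j) v * y v) ≡ (- + 1 + - + 1) * ⟦ J k ⟧
      hole-value k {i} {j} i≢j = begin
        ∑[ v < m ℕ.* n ] H (remQuot {m} n v)
          ≡⟨ ∑-remQuot m n H ⟩
        ∑[ i′ < m ] ∑[ k′ < n ] H (i′ , k′)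
          ≡⟨ sum-cong-≗ (λ i′ → ∑-concentrated _ k (other-columns-vanish i′)) ⟩
        ∑[ i′ < m ] H (i′ , k)
          ≡⟨ sum-cong-≗ (λ i′ →
               cong (λ p → (if p ∧ B i′ then - + 1 else + 0) * ⟦ J k ⟧) (eqb-refl k)) ⟩
        ∑[ i′ < m ] ((if B i′ then - + 1 else + 0) * ⟦ J k ⟧)
          ≡⟨ *-distribʳ-sum ⟦ J k ⟧ (λ i′ → if B i′ then - + 1 else + 0) ⟨
        ∑[ i′ < m ] (if B i′ then - + 1 else + 0) * ⟦ J k ⟧
          ≡⟨ cong (_* ⟦ J k ⟧) (∑-indicator-pair (- + 1) i≢j) ⟩
        (- + 1 + - + 1) * ⟦ J k ⟧ ∎
        where
          open ≡-Reasoning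
          B : Fin m → Bool
          B i′ = eqb i′ i ∨ eqb i′ j
          H : Fin m × Fin n → ℤ
          H (i′ , k′) = (if eqb k′ k ∧ B i′ then - + 1 else + 0) * ⟦ J k′ ⟧
          other-columns-vanish : ∀ i′ k′ → k′ ≢ k → H (i′ , k′) ≡ + 0
          other-columns-vanish i′ k′ k′≢k rewrite eqb-≢ k′≢k = ℤP.*-zeroˡ ⟦ J k′ ⟧

      satisfies-PHP : Nonzero J → (λ _ → true) · J ≡ false → ∀ c → Sat (ineq (PHP m n) c) (half y)
      satisfies-PHP nonzero even (inj₁ i) =
        sat-half (coeff (pigeonIneq m n i)) (+ 1) y
          (subst (+ 2 ℤ.≤_) (sym (pigeon-value i)) (even-support-≥2 J nonzero even))
      satisfies-PHP _ _ (inj₂ (k , (i , j) , i≢j)) =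
        sat-half (coeff (holeIneq m n k i j)) (- + 1) y
          (subst (- + 1 * + 2 ℤ.≤_) (sym (hole-value k i≢j)) (hole-bound (J k)))
        where
          hole-bound : ∀ b → - + 1 * + 2 ℤ.≤ (- + 1 + - + 1) * ⟦ b ⟧
          hole-bound true  = ℤP.≤-refl
          hole-bound false = ℤ.-≤+

module Refutations where

  open import Data.Bool using (Bool; true; false)
  open import Data.Integer using (ℤ)
  open import Data.List using (List; []; _∷_; _++_; map; length)
  open import Data.List.Properties using (length-map; length-++)
  open import Data.List.Relation.Unary.All using (All; []; _∷_)
  open import Data.List.Relation.Unary.All.Properties using (++⁻; map⁻)
  open import Data.Product using (∃-syntax; _×_)
  open import Data.Rational using (ℚ)
  open import Data.Sum using (_⊎_; inj₁; inj₂)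
  open import Data.Vec.Functional using (Vector)
  open import Relation.Binary.PropositionalEquality
  open import Relation.Nullary using (¬_)
  open 𝔽₂-Linear using (_·_; Nonzero; kernel-nontrivial)
  open HalfIntegralPoints using (half)
  open PigeonholePoint using (columnParity; columnIndicator; satisfies-PHP; decides-even-column-query)

  queries : ∀ {N} → SPTree N → List (Vector ℤ N)
  queries leaf            = []
  queries (query a b l r) = a ∷ queries l ++ queries r

  length-queries : ∀ {N} (T : SPTree N) → length (queries T) ≡ spLength T
  length-queries leaf            = refl
  length-queries (query a b l r) =
    cong suc (trans (length-++ (queries l)) (cong₂ ℕ._+_ (length-queries l) (length-queries r)))

  -- Follow x down T, at each query along the edge that x satisfies.
  feasible-point-¬refutesFrom : ∀ {N} {P : Vector ℤ N → Set}
    (F : System N) path (T : SPTree N) (x : Vector ℚ N) →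
    (∀ c → Sat (ineq F c) x) → All (λ c → Sat c x) path →
    (∀ a b → P a → Sat (geqEdge a b) x ⊎ Sat (leqEdge a b) x) → All P (queries T) →
    ¬ RefutesFrom F path T
  feasible-point-¬refutesFrom F path leaf x x∈F x∈path decides _ infeasible = infeasible (x , x∈F , x∈path)
  feasible-point-¬refutesFrom F path (query a b l r) x x∈F x∈path decides (Pa ∷ Pqs) (refutesˡ , refutesʳ)
    with ++⁻ (queries l) Pqs | decides a b Pa
  ... | Pl , _  | inj₁ x≥ = feasible-point-¬refutesFrom F _ l x x∈F (x≥ ∷ x∈path) decides Pl refutesˡ
  ... | _  , Pr | inj₂ x≤ = feasible-point-¬refutesFrom F _ r x x∈F (x≤ ∷ x∈path) decides Pr refutesʳ

  php-refutation-length : ∀ m n (T : SPTree (m ℕ.* n)) → IsSPRefutation (PHP m n) T → n ℕ.≤ suc (spLength T)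
  php-refutation-length m n T refutes = ℕP.≮⇒≥ λ few-queries →
    no-common-root (kernel-nontrivial n forms (subst (ℕ._< n) (sym length-forms) few-queries))
    where
      forms : List (Vector Bool n)
      forms = (λ _ → true) ∷ map (columnParity m n) (queries T)
      length-forms : length forms ≡ suc (spLength T)
      length-forms = cong suc (trans (length-map (columnParity m n) (queries T)) (length-queries T))
      no-common-root : ¬ (∃[ J ] Nonzero J × All (λ c → c · J ≡ false) forms)
      no-common-root (J , nonzero , even ∷ even-columns) =
        feasible-point-¬refutesFrom (PHP m n) [] T (half (columnIndicator m n J))
          (satisfies-PHP m n J nonzero even) []
          (decides-even-column-query m n J) (map⁻ even-columns) refutes

open import Data.Nat using (_+_; _*_; _^_; _≤_; _≥_)
open import Relation.Binary.PropositionalEquality using (cong)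
open Refutations using (php-refutation-length)

≤1+L⇒≤2L⁴ : ∀ {n} L → 2 ≤ n → n ≤ suc L → n ≤ 2 * L ^ 4
≤1+L⇒≤2L⁴ zero    (s≤s (s≤s _)) (s≤s ())
≤1+L⇒≤2L⁴ {n} (suc K) _ n≤2+K = begin
  n                ≤⟨ n≤2+K ⟩
  1 + suc K        ≤⟨ ℕP.+-monoˡ-≤ (suc K) (s≤s z≤n) ⟩
  suc K + suc K    ≡⟨ cong (suc K +_) (ℕP.+-identityʳ (suc K)) ⟨
  2 * suc K        ≤⟨ ℕP.*-monoʳ-≤ 2 (ℕP.m≤m*n (suc K) (suc K ^ 3)) ⟩
  2 * suc K ^ 4    ∎
  where open ℕP.≤-Reasoning

mainTheorem2 : (d : ℕ) → d ≥ 1 →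
    Σ ℕ λ c → Σ ℕ λ N₀ →
      (n : ℕ) → n ≥ N₀ → (T : SPTree ((n + d) * n)) →
        IsSPRefutation (PHP (n + d) n) T → n ≤ c * (spLength T ^ 4)
mainTheorem2 d _ = 2 , 2 , λ n 2≤n T refutes →
  ≤1+L⇒≤2L⁴ (spLength T) 2≤n (php-refutation-length (n + d) n T refutes)
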